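{- A predicate $\phi$ on a set $A$ is $\neg\neg$-dense if and only if $\phi\sqsubseteq\mathsf{LEM}$.
   Context: Work in intuitionistic higher-order logic (e.g. the internal language of an elementary topos), without excluded middle and without countable choice. $\Omega$ is the set of truth values. A predicate $\phi$ on $A$ is instance reducible to a predicate $\psi$ on $B$, written $\phi\sqsubseteq\psi$, when $\forall x\in A\,\exists y\in B\,(\psi(y)\Rightarrow\phi(x))$. A predicate $\phi$ on $A$ is $\neg\neg$-dense when $\neg\exists x\in A.\,\neg\phi(x)$, equivalently $\forall x\in A.\,\neg\neg\phi(x)$. $\mathsf{LEM}$ is the predicate on $\Omega$ given by $\mathsf{LEM}(p)\equiv(p\vee\neg p)$. -}

module Defs where

open import Level using (Level; _⊔_) renaming (suc to lsuc)
open import Data.Product using (∃-syntax)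
open import Data.Sum using (_⊎_)
open import Relation.Nullary using (¬_)

-- Ω : truth values, rendered propositions-as-types as the universe Set ℓ.
Ω : (ℓ : Level) → Set (lsuc ℓ)
Ω ℓ = Set ℓ

Pred : ∀ {a} → Set a → (ℓ : Level) → Set (a ⊔ lsuc ℓ)
Pred A ℓ = A → Ω ℓ

_⊑_ : ∀ {a b ℓ ℓ'} {A : Set a} {B : Set b} → Pred A ℓ → Pred B ℓ' → Set (a ⊔ b ⊔ ℓ ⊔ ℓ')
_⊑_ {A = A} {B = B} φ ψ = (x : A) → ∃[ y ] (ψ y → φ x)

¬¬Dense : ∀ {a ℓ} {A : Set a} → Pred A ℓ → Set (a ⊔ ℓ)
¬¬Dense {A = A} φ = ¬ (∃[ x ] ¬ φ x)

LEM : ∀ {ℓ} → Pred (Ω ℓ) ℓ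
LEM p = p ⊎ ¬ p

-- Any instance of LEM is ¬¬-true, so anything it implies is ¬¬-true; conversely,
-- if φ x is ¬¬-true then the LEM instance at the proposition φ x itself implies φ x.
module Submission where

open import Defs
open import Data.Product using (_×_; _,_; proj₂)
open import Data.Sum using (inj₁; inj₂)
open import Relation.Nullary using (¬_)
open import Relation.Nullary.Negation using (¬¬-map; ¬∃⟶∀¬; contradiction)
open import Relation.Nullary.Decidable using (toSum; ¬¬-excluded-middle)

¬¬LEM : ∀ {ℓ} (p : Ω ℓ) → ¬ ¬ LEM p
¬¬LEM p = ¬¬-map toSum ¬¬-excluded-middle

¬¬⇒LEM⇒ : ∀ {ℓ} {p : Ω ℓ} → ¬ ¬ p → LEM p → p
¬¬⇒LEM⇒ _   (inj₁ x)  = x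
¬¬⇒LEM⇒ ¬¬x (inj₂ ¬x) = contradiction ¬x ¬¬x

LEM⇒-¬¬ : ∀ {ℓ ℓ'} {p : Ω ℓ} {q : Ω ℓ'} → (LEM q → p) → ¬ ¬ p
LEM⇒-¬¬ {q = q} f = ¬¬-map f (¬¬LEM q)

¬¬Dense⇒⊑LEM : ∀ {a ℓ} {A : Set a} (φ : Pred A ℓ) → ¬¬Dense φ → φ ⊑ LEM {ℓ}
¬¬Dense⇒⊑LEM φ dense x = φ x , ¬¬⇒LEM⇒ (¬∃⟶∀¬ dense x)

⊑LEM⇒¬¬Dense : ∀ {a ℓ} {A : Set a} (φ : Pred A ℓ) → φ ⊑ LEM {ℓ} → ¬¬Dense φ
⊑LEM⇒¬¬Dense φ reduce (x , ¬φx) = LEM⇒-¬¬ (proj₂ (reduce x)) ¬φx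

proposition2p15 : ∀ {a ℓ} {A : Set a} (φ : Pred A ℓ) →
    (¬¬Dense φ → φ ⊑ LEM {ℓ}) × (φ ⊑ LEM {ℓ} → ¬¬Dense φ)
proposition2p15 φ = ¬¬Dense⇒⊑LEM φ , ⊑LEM⇒¬¬Dense φ
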